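{- Let $n\ge 3$ be odd, $r\in[n+1]$ and $\pi=(\pi_1,\dots,\pi_n)\in S_n$, and let $\hat\pi=(n+1-\pi_n,\dots,n+1-\pi_1)$. Then the toppling dynamics starting from $\pi^{(r)}$ is isomorphic to the toppling dynamics starting from $\hat\pi^{(n+2-r)}$ via the map on configurations that reflects positions about the origin ($x\mapsto -x$) and replaces each chip label $i$ by $n+2-i$. Consequently, $\pi$ is $r$-toppleable if and only if $\hat\pi$ is $(n+2-r)$-toppleable.
   Context: For an integer $n\ge 2$ let $L_n=\{ -\lfloor (n+1)/2\rfloor,\dots,\lfloor n/2\rfloor+1\}\subset\mathbb{Z}$; position $0$ is the origin. A toppling move chooses a position $i$ holding at least two chips, chooses two chips $\alpha<\beta$ at $i$, and moves $\alpha$ to $i-1$ and $\beta$ to $i+1$; the toppling process applies such moves until no position holds two or more chips. For $\pi\in S_n$ and $r\in[n+1]$, the initial configuration $\pi^{(r)}$ has, for $j=1,\dots,n$, one chip at position $-\lfloor (n-1)/2\rfloor+j-1$ labeled $\pi_j$ if $\pi_j<r$ and $\pi_j+1$ if $\pi_j\ge r$, plus a chip labeled $r$ at the origin. The final configuration does not depend on the choices and has at most one chip per position; reading chips left to right gives $\mathcal{T}(\pi,r)\in S_{n+1}$. $\pi$ is $r$-toppleable if $\mathcal{T}(\pi,r)$ is the identity permutation. -}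

module Defs where

open import Data.Nat as ℕ using (ℕ; suc; _∸_; _/_)
open import Data.Integer as ℤ using (ℤ; +_; -_; _+_; _-_)
open import Data.Fin using (Fin; toℕ; opposite; punchIn; punchOut; _≟_)
open import Data.Fin.Properties using (opposite-involutive)
open import Data.Fin.Permutation using (Permutation′; permutation; _⟨$⟩ʳ_; _⟨$⟩ˡ_; _∘ₚ_)
open import Data.Product using (Σ; _×_)
open import Relation.Nullary using (yes; no; ¬_)
open import Relation.Binary.PropositionalEquality using (_≡_)
open import Relation.Binary.Construct.Closure.ReflexiveTransitive using (Star)

-- Conventions: labels 1..n+1 are encoded 0-based as Fin (suc n) (label ℓ ↔ toℕ ℓ + 1),
-- so label order is the order on Fin.  Since all chips carry distinct labels, a
-- configuration of the n+1 chips is the function  label ↦ position (∈ ℤ).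
Config : ℕ → Set
Config n = Fin (suc n) → ℤ

Step : ∀ {n} → Config n → Config n → Set
Step {n} C D =
  Σ (Fin (suc n)) λ α → Σ (Fin (suc n)) λ β →
    Data.Fin._<_ α β × C α ≡ C β ×
    D α ≡ C α - + 1 × D β ≡ C β + + 1 ×
    (∀ γ → ¬ γ ≡ α → ¬ γ ≡ β → D γ ≡ C γ)

Reachable : ∀ {n} → Config n → Config n → Set
Reachable = Star Step

Stable : ∀ {n} → Config n → Set
Stable {n} C = ∀ (α β : Fin (suc n)) → C α ≡ C β → α ≡ β

ReadsIdentity : ∀ {n} → Config n → Set
ReadsIdentity {n} C = ∀ (α β : Fin (suc n)) → Data.Fin._<_ α β → ℤ._<_ (C α) (C β)

slotPos : ∀ {n} → Fin n → ℤ
slotPos {n} j = - (+ ((n ∸ 1) / 2)) + + toℕ j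

-- Initial configuration π^(r) (r 0-based, encoding r ∈ [n+1]):
-- chip labeled r at the origin; the chip in slot j carries label punchIn r (π j),
-- i.e. π_j if π_j < r and π_j + 1 otherwise.
initConfig : ∀ {n} → Permutation′ n → Fin (suc n) → Config n
initConfig π r ℓ with r ≟ ℓ
... | yes _  = + 0
... | no r≢ℓ = slotPos (π ⟨$⟩ˡ punchOut r≢ℓ)

reversal : ∀ {n} → Permutation′ n
reversal = permutation opposite opposite opposite-involutive opposite-involutive

hat : ∀ {n} → Permutation′ n → Permutation′ n
hat π = reversal ∘ₚ (π ∘ₚ reversal)

reflect : ∀ {n} → Config n → Config n
reflect C ℓ = - C (opposite ℓ)

-- The toppling process from π^(r) ends at a stable configuration (unique by the
-- paper's confluence result); π is r-toppleable iff that final configuration reads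
-- as the identity permutation.
Toppleable : ∀ {n} → Permutation′ n → Fin (suc n) → Set
Toppleable {n} π r =
  Σ (Config n) λ C → Reachable (initConfig π r) C × Stable C × ReadsIdentity C

-- The map C ↦ reflect C (negate positions, reverse labels) is an involution that
-- turns a move of chips α < β into a move of the chips opposite β < opposite α, so
-- it carries toppling sequences to toppling sequences and preserves stability and
-- the sortedness of the final configuration.  For odd n the slots of π^(r) are
-- symmetric about the origin, and reflecting π^(r) gives exactly π̂^(n+2-r).
module Submission where

open import Defs
open import Data.Nat as ℕ using (ℕ; suc; _≤_; _<_; _%_; _∸_; _/_; _≤?_; s≤s; s≤s⁻¹)
open import Data.Nat.Properties
  using (+-comm; +-identityʳ; *-comm; ≰⇒>; ≮⇒≥; m≤o∸n⇒m+n≤o; m+n≤o⇒m≤o∸n;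
         +-∸-assoc; ∸-+-assoc; m∸n+n≡m; ∸-monoˡ-≤; ∸-monoʳ-<)
open import Data.Nat.DivMod using (m≡m%n+[m/n]*n; m*n/n≡m)
open import Data.Integer as ℤ using (ℤ; +_; -_; _+_; _-_)
open import Data.Integer.Properties using (neg-involutive; neg-distrib-+; neg-injective; neg-mono-<; pos-+)
open import Data.Integer.Solver using (module +-*-Solver)
open import Data.Fin as Fin using (Fin; zero; toℕ; opposite; punchIn; punchOut; _≟_)
open import Data.Fin.Properties
  using (opposite-prop; opposite-involutive; toℕ-injective; toℕ<n; punchIn-punchOut; punchIn-injective)
open import Data.Fin.Permutation using (Permutation′; _⟨$⟩ˡ_)
open import Data.Product using (Σ; _×_; _,_)
open import Data.Empty using (⊥-elim)
open import Relation.Nullary using (¬_; Dec; yes; no)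
open import Relation.Binary.PropositionalEquality
  using (_≡_; _≗_; refl; sym; trans; cong; subst; subst₂; cong₂; module ≡-Reasoning)
open import Relation.Binary.Construct.Closure.ReflexiveTransitive using (ε; _◅_; gmap)
open import Function.Bundles using (_⇔_; mk⇔)

≤∸suc⇒<∸ : ∀ {a b n} → b < n → a ≤ n ∸ suc b → b < n ∸ a
≤∸suc⇒<∸ {a} {b} {n} b<n p =
  m+n≤o⇒m≤o∸n (suc b) (subst (_≤ n) (+-comm a (suc b)) (m≤o∸n⇒m+n≤o a b<n p))

<∸⇒≤∸suc : ∀ {a b n} → a ≤ n → b < n ∸ a → a ≤ n ∸ suc b
<∸⇒≤∸suc {a} {b} {n} a≤n q =
  m+n≤o⇒m≤o∸n a (subst (_≤ n) (+-comm (suc b) a) (m≤o∸n⇒m+n≤o (suc b) a≤n q))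

toℕ-punchIn-< : ∀ {n} (i : Fin (suc n)) (j : Fin n) → toℕ j < toℕ i → toℕ (punchIn i j) ≡ toℕ j
toℕ-punchIn-< (Fin.suc i) zero        _       = refl
toℕ-punchIn-< (Fin.suc i) (Fin.suc j) (s≤s p) = cong suc (toℕ-punchIn-< i j p)

toℕ-punchIn-≥ : ∀ {n} (i : Fin (suc n)) (j : Fin n) → toℕ i ≤ toℕ j → toℕ (punchIn i j) ≡ suc (toℕ j)
toℕ-punchIn-≥ zero        j           _       = refl
toℕ-punchIn-≥ (Fin.suc i) (Fin.suc j) (s≤s p) = cong suc (toℕ-punchIn-≥ i j p)

punchIn-opposite : ∀ {n} (r : Fin (suc n)) (k : Fin n) →
  punchIn r (opposite k) ≡ opposite (punchIn (opposite r) k)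
punchIn-opposite {n} r k = toℕ-injective (trans (cases (toℕ r ≤? n ∸ suc (toℕ k)))
                                                (sym (opposite-prop (punchIn (opposite r) k))))
  where
  open ≡-Reasoning
  r̄ : toℕ (opposite r) ≡ n ∸ toℕ r
  r̄ = opposite-prop r
  k̄ : toℕ (opposite k) ≡ n ∸ suc (toℕ k)
  k̄ = opposite-prop k
  r≤n : toℕ r ≤ n
  r≤n = s≤s⁻¹ (toℕ<n r)
  cases : Dec (toℕ r ≤ n ∸ suc (toℕ k)) → toℕ (punchIn r (opposite k)) ≡ n ∸ toℕ (punchIn (opposite r) k)
  cases (yes r≤) = begin
    toℕ (punchIn r (opposite k))      ≡⟨ toℕ-punchIn-≥ r (opposite k) (subst (toℕ r ≤_) (sym k̄) r≤) ⟩
    suc (toℕ (opposite k))            ≡⟨ cong suc k̄ ⟩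
    suc (n ∸ suc (toℕ k))             ≡⟨ +-∸-assoc 1 (toℕ<n k) ⟨
    n ∸ toℕ k                         ≡⟨ cong (n ∸_) (toℕ-punchIn-< (opposite r) k k<r̄) ⟨
    n ∸ toℕ (punchIn (opposite r) k)  ∎
    where
    k<r̄ : toℕ k < toℕ (opposite r)
    k<r̄ = subst (toℕ k <_) (sym r̄) (≤∸suc⇒<∸ (toℕ<n k) r≤)
  cases (no r≰) = begin
    toℕ (punchIn r (opposite k))      ≡⟨ toℕ-punchIn-< r (opposite k) (subst (_< toℕ r) (sym k̄) (≰⇒> r≰)) ⟩
    toℕ (opposite k)                  ≡⟨ k̄ ⟩
    n ∸ suc (toℕ k)                   ≡⟨ cong (n ∸_) (toℕ-punchIn-≥ (opposite r) k r̄≤k) ⟨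
    n ∸ toℕ (punchIn (opposite r) k)  ∎
    where
    r̄≤k : toℕ (opposite r) ≤ toℕ k
    r̄≤k = subst (_≤ toℕ k) (sym r̄) (≮⇒≥ (λ k<r̄ → r≰ (<∸⇒≤∸suc r≤n k<r̄)))

opposite-punchOut : ∀ {n} {r ℓ : Fin (suc n)} (r≢ℓ̄ : ¬ r ≡ opposite ℓ) (r̄≢ℓ : ¬ opposite r ≡ ℓ) →
  opposite (punchOut r̄≢ℓ) ≡ punchOut r≢ℓ̄
opposite-punchOut {r = r} {ℓ} r≢ℓ̄ r̄≢ℓ = punchIn-injective r _ _ (begin
  punchIn r (opposite (punchOut r̄≢ℓ))            ≡⟨ punchIn-opposite r (punchOut r̄≢ℓ) ⟩
  opposite (punchIn (opposite r) (punchOut r̄≢ℓ)) ≡⟨ cong opposite (punchIn-punchOut r̄≢ℓ) ⟩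
  opposite ℓ                                     ≡⟨ punchIn-punchOut r≢ℓ̄ ⟨
  punchIn r (punchOut r≢ℓ̄)                       ∎)
  where open ≡-Reasoning

opposite-mono-< : ∀ {n} {α β : Fin n} → α Fin.< β → opposite β Fin.< opposite α
opposite-mono-< {suc n} {α} {β} α<β =
  subst₂ _<_ (sym (opposite-prop β)) (sym (opposite-prop α)) (∸-monoʳ-< (s≤s α<β) (toℕ<n β))

odd⇒pred≡half+half : ∀ n → n % 2 ≡ 1 → n ∸ 1 ≡ (n ∸ 1) / 2 ℕ.+ (n ∸ 1) / 2
odd⇒pred≡half+half n odd = begin
  n ∸ 1                        ≡⟨ n∸1≡2h ⟩
  h ℕ.* 2                      ≡⟨ *-comm h 2 ⟩
  h ℕ.+ (h ℕ.+ 0)              ≡⟨ cong (h ℕ.+_) (+-identityʳ h) ⟩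
  h ℕ.+ h                      ≡⟨ cong₂ ℕ._+_ half≡h half≡h ⟨
  (n ∸ 1) / 2 ℕ.+ (n ∸ 1) / 2  ∎
  where
  open ≡-Reasoning
  h : ℕ
  h = n / 2
  n∸1≡2h : n ∸ 1 ≡ h ℕ.* 2
  n∸1≡2h = cong (_∸ 1) (trans (m≡m%n+[m/n]*n n 2) (cong (ℕ._+ h ℕ.* 2) odd))
  half≡h : (n ∸ 1) / 2 ≡ h
  half≡h = trans (cong (_/ 2) n∸1≡2h) (m*n/n≡m h 2)

-h+d≡-[-h+t] : ∀ h d t → d ℕ.+ t ≡ h ℕ.+ h → - (+ h) + + d ≡ - (- (+ h) + + t)
-h+d≡-[-h+t] h d t d+t≡h+h = begin
  - (+ h) + + d                ≡⟨ solve 3 (λ H D T → :- H :+ D := (D :+ T) :- H :- T) refl (+ h) (+ d) (+ t) ⟩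
  (+ d + + t) - + h - + t      ≡⟨ cong (λ x → x - + h - + t) d+t≡h+hℤ ⟩
  (+ h + + h) - + h - + t      ≡⟨ solve 2 (λ H T → (H :+ H) :- H :- T := :- (:- H :+ T)) refl (+ h) (+ t) ⟩
  - (- (+ h) + + t)            ∎
  where
  open ≡-Reasoning
  open +-*-Solver
  d+t≡h+hℤ : + d + + t ≡ + h + + h
  d+t≡h+hℤ = trans (sym (pos-+ d t)) (trans (cong +_ d+t≡h+h) (pos-+ h h))

slotPos-opposite : ∀ n → n % 2 ≡ 1 → (j : Fin n) → slotPos {n} (opposite j) ≡ - slotPos {n} j
slotPos-opposite n odd j =
  trans (cong (λ x → - (+ h) + + x) (opposite-prop j)) (-h+d≡-[-h+t] h (n ∸ suc t) t d+t≡h+h)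
  where
  h t : ℕ
  h = (n ∸ 1) / 2
  t = toℕ j
  d+t≡h+h : n ∸ suc t ℕ.+ t ≡ h ℕ.+ h
  d+t≡h+h = begin
    n ∸ suc t ℕ.+ t    ≡⟨ cong (ℕ._+ t) (∸-+-assoc n 1 t) ⟨
    n ∸ 1 ∸ t ℕ.+ t    ≡⟨ m∸n+n≡m (∸-monoˡ-≤ 1 (toℕ<n j)) ⟩
    n ∸ 1              ≡⟨ odd⇒pred≡half+half n odd ⟩
    h ℕ.+ h            ∎
    where open ≡-Reasoning

reflect-initConfig : ∀ n → n % 2 ≡ 1 → (π : Permutation′ n) (r : Fin (suc n)) →
  reflect (initConfig π r) ≗ initConfig (hat π) (opposite r)
reflect-initConfig n odd π r ℓ with r ≟ opposite ℓ | opposite r ≟ ℓ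
... | yes _    | yes _    = refl
... | yes r≡ℓ̄ | no r̄≢ℓ   = ⊥-elim (r̄≢ℓ (trans (cong opposite r≡ℓ̄) (opposite-involutive ℓ)))
... | no r≢ℓ̄  | yes r̄≡ℓ  = ⊥-elim (r≢ℓ̄ (trans (sym (opposite-involutive r)) (cong opposite r̄≡ℓ)))
... | no r≢ℓ̄  | no r̄≢ℓ   = sym (begin
  slotPos (opposite (π ⟨$⟩ˡ opposite (punchOut r̄≢ℓ)))  ≡⟨ slotPos-opposite n odd _ ⟩
  - slotPos (π ⟨$⟩ˡ opposite (punchOut r̄≢ℓ))          ≡⟨ cong (λ k → - slotPos (π ⟨$⟩ˡ k)) (opposite-punchOut r≢ℓ̄ r̄≢ℓ) ⟩
  - slotPos (π ⟨$⟩ˡ punchOut r≢ℓ̄)                     ∎)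
  where open ≡-Reasoning

reflect-involutive : ∀ {n} (C : Config n) → reflect (reflect C) ≗ C
reflect-involutive C ℓ = trans (neg-involutive _) (cong C (opposite-involutive ℓ))

reflect-resp-≗ : ∀ {n} {C D : Config n} → C ≗ D → reflect C ≗ reflect D
reflect-resp-≗ C≗D ℓ = cong -_ (C≗D (opposite ℓ))

Step-resp-≗ : ∀ {n} {C C′ D D′ : Config n} → C ≗ C′ → D ≗ D′ → Step C D → Step C′ D′
Step-resp-≗ C≗C′ D≗D′ (α , β , α<β , Cα≡Cβ , Dα≡ , Dβ≡ , others) =
  α , β , α<β ,
  trans (sym (C≗C′ α)) (trans Cα≡Cβ (C≗C′ β)) ,
  trans (sym (D≗D′ α)) (trans Dα≡ (cong (_- + 1) (C≗C′ α))) ,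
  trans (sym (D≗D′ β)) (trans Dβ≡ (cong (_+ + 1) (C≗C′ β))) ,
  λ γ γ≢α γ≢β → trans (sym (D≗D′ γ)) (trans (others γ γ≢α γ≢β) (C≗C′ γ))

reflect-opposite : ∀ {n} (C : Config n) ℓ → reflect C (opposite ℓ) ≡ - C ℓ
reflect-opposite C ℓ = cong (λ k → - C k) (opposite-involutive ℓ)

opposite-≢ : ∀ {n} {γ ℓ : Fin n} → ¬ γ ≡ opposite ℓ → ¬ opposite γ ≡ ℓ
opposite-≢ {γ = γ} γ≢ℓ̄ γ̄≡ℓ = γ≢ℓ̄ (trans (sym (opposite-involutive γ)) (cong opposite γ̄≡ℓ))

reflect-Step : ∀ {n} {C D : Config n} → Step C D → Step (reflect C) (reflect D)
reflect-Step {C = C} {D} (α , β , α<β , Cα≡Cβ , Dα≡ , Dβ≡ , others) =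
  opposite β , opposite α , opposite-mono-< α<β ,
  (begin
    reflect C (opposite β)        ≡⟨ reflect-opposite C β ⟩
    - C β                         ≡⟨ cong -_ Cα≡Cβ ⟨
    - C α                         ≡⟨ reflect-opposite C α ⟨
    reflect C (opposite α)        ∎) ,
  (begin
    reflect D (opposite β)        ≡⟨ reflect-opposite D β ⟩
    - D β                         ≡⟨ cong -_ Dβ≡ ⟩
    - (C β + + 1)                 ≡⟨ neg-distrib-+ (C β) (+ 1) ⟩
    - C β - + 1                   ≡⟨ cong (_- + 1) (reflect-opposite C β) ⟨
    reflect C (opposite β) - + 1  ∎) ,
  (begin
    reflect D (opposite α)        ≡⟨ reflect-opposite D α ⟩
    - D α                         ≡⟨ cong -_ Dα≡ ⟩
    - (C α - + 1)                 ≡⟨ neg-distrib-+ (C α) (- + 1) ⟩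
    - C α + + 1                   ≡⟨ cong (_+ + 1) (reflect-opposite C α) ⟨
    reflect C (opposite α) + + 1  ∎) ,
  λ γ γ≢β̄ γ≢ᾱ → cong -_ (others (opposite γ) (opposite-≢ γ≢ᾱ) (opposite-≢ γ≢β̄))
  where open ≡-Reasoning

Step⇔reflect-Step : ∀ {n} (C D : Config n) → Step C D ⇔ Step (reflect C) (reflect D)
Step⇔reflect-Step C D =
  mk⇔ reflect-Step (λ s → Step-resp-≗ (reflect-involutive C) (reflect-involutive D) (reflect-Step s))

ToppleableFrom : ∀ {n} → Config n → Set
ToppleableFrom {n} C₀ = Σ (Config n) λ C → Reachable C₀ C × Stable C × ReadsIdentity C

-- Only the first move of a nonempty toppling sequence sees C₀.
ToppleableFrom-resp-≗ : ∀ {n} {C₀ C₀′ : Config n} → C₀ ≗ C₀′ → ToppleableFrom C₀ → ToppleableFrom C₀′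
ToppleableFrom-resp-≗ {C₀′ = C₀′} C₀≗C₀′ (C , ε , stable , sorted) =
  C₀′ , ε ,
  (λ α β eq → stable α β (trans (C₀≗C₀′ α) (trans eq (sym (C₀≗C₀′ β))))) ,
  (λ α β α<β → subst₂ ℤ._<_ (C₀≗C₀′ α) (C₀≗C₀′ β) (sorted α β α<β))
ToppleableFrom-resp-≗ C₀≗C₀′ (C , step ◅ steps , final) =
  C , Step-resp-≗ C₀≗C₀′ (λ _ → refl) step ◅ steps , final

reflect-ToppleableFrom : ∀ {n} {C₀ : Config n} → ToppleableFrom C₀ → ToppleableFrom (reflect C₀)
reflect-ToppleableFrom (C , steps , stable , sorted) =
  reflect C , gmap reflect reflect-Step steps ,
  (λ α β eq → trans (sym (opposite-involutive α))
                (trans (cong opposite (stable _ _ (neg-injective eq))) (opposite-involutive β))) ,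
  (λ α β α<β → neg-mono-< (sorted _ _ (opposite-mono-< α<β)))

proposition2p3 : (n : ℕ) → 3 ≤ n → n % 2 ≡ 1 →
    (r : Fin (suc n)) → (π : Permutation′ n) →
    ((∀ ℓ → reflect (initConfig π r) ℓ ≡ initConfig (hat π) (opposite r) ℓ)
    × (∀ (C : Config n) ℓ → reflect (reflect C) ℓ ≡ C ℓ)
    × (∀ (C D : Config n) → Step C D ⇔ Step (reflect C) (reflect D)))
    × (Toppleable π r ⇔ Toppleable (hat π) (opposite r))
proposition2p3 n _ odd r π =
  (reflect-π^r , reflect-involutive , Step⇔reflect-Step) ,
  mk⇔ (λ t → ToppleableFrom-resp-≗ reflect-π^r (reflect-ToppleableFrom t))
      (λ t → ToppleableFrom-resp-≗ reflect-π̂^r̄ (reflect-ToppleableFrom t))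
  where
  reflect-π^r : reflect (initConfig π r) ≗ initConfig (hat π) (opposite r)
  reflect-π^r = reflect-initConfig n odd π r
  reflect-π̂^r̄ : reflect (initConfig (hat π) (opposite r)) ≗ initConfig π r
  reflect-π̂^r̄ ℓ = trans (sym (reflect-resp-≗ reflect-π^r ℓ)) (reflect-involutive (initConfig π r) ℓ)
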